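{- Let $T$ be a full binary tree and let $aug(T)$ be an augmented tree of $T$ (as defined in the context). Then $\mathrm{cost}(aug(T))\le \frac{3}{2}\,\mathrm{cost}(T)$, where $\mathrm{cost}$ of a rooted tree denotes the sum, over all its leaves, of the depth of the leaf.
   Context: A full binary tree is a rooted tree in which every internal node has exactly two children. The depth of a node is its distance from the root (the root has depth $0$). For a node $x$, $L(T[x])$ denotes the set of leaves of the subtree of $T$ rooted at $x$. The augmented tree $aug(T)$ is obtained from $T$ as follows: for every internal node $v$ of $T$ with children $c_l,c_r$, choose one child, say $c_r$, with $|L(T[c_r])|\le |L(T[c_l])|$ (ties broken arbitrarily), and subdivide the edge $vc_r$ once (inserting one new node of degree two). All these subdivisions are performed simultaneously, one per internal node of $T$. -}

module Defs where

open import Data.Nat using (ℕ; zero; suc; _+_; _≤_)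

data BT : Set where
  leaf : BT
  node : BT → BT → BT

-- Rooted trees whose internal nodes have one or two children
-- (the shape of aug(T): subdivision nodes have exactly one child).
data UT : Set where
  uleaf  : UT
  unary  : UT → UT
  binary : UT → UT → UT

leaves : BT → ℕ
leaves leaf = 1
leaves (node l r) = leaves l + leaves r

-- cost = sum over leaves of their depth.
-- Auxiliary: sum over leaves of (d + depth), for a subtree hung at depth d.
costAt : ℕ → BT → ℕ
costAt d leaf = d
costAt d (node l r) = costAt (suc d) l + costAt (suc d) r

cost : BT → ℕ
cost = costAt 0

ucostAt : ℕ → UT → ℕ
ucostAt d uleaf = d
ucostAt d (unary t) = ucostAt (suc d) t
ucostAt d (binary l r) = ucostAt (suc d) l + ucostAt (suc d) r

ucost : UT → ℕ
ucost = ucostAt 0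

-- IsAug T A : A is an augmented tree aug(T) of T. At every internal node
-- of T, the edge to a child with the (weakly) fewer leaves is subdivided
-- once; ties may be broken either way.
data IsAug : BT → UT → Set where
  aug-leaf  : IsAug leaf uleaf
  aug-right : ∀ {l r l′ r′} → leaves r ≤ leaves l →
              IsAug l l′ → IsAug r r′ →
              IsAug (node l r) (binary l′ (unary r′))
  aug-left  : ∀ {l r l′ r′} → leaves l ≤ leaves r →
              IsAug l l′ → IsAug r r′ →
              IsAug (node l r) (binary (unary l′) r′)

{-# OPTIONS --safe #-}
-- The cost of a tree is the sum, over its non-root nodes x, of |L(T[x])|; so
-- every internal node v contributes |L(T[v])| to cost T.  Subdividing the edge
-- from v to its smaller child c deepens exactly the leaves below c, adding
-- |L(T[c])| ≤ |L(T[v])| / 2.  Summed over v, augmentation adds at most cost T / 2.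
module Submission where

open import Defs
open import Data.Nat using (ℕ; _*_; _≤_; _+_; suc; z≤n)
open import Data.Nat.Properties
  using (+-commutativeSemigroup; +-comm; +-identityʳ; +-monoˡ-≤; +-monoʳ-≤; +-mono-≤;
         *-distribˡ-+; module ≤-Reasoning)
open import Data.Nat.Tactic.RingSolver using (solve-∀)
open import Algebra.Properties.CommutativeSemigroup +-commutativeSemigroup using (interchange)
open import Relation.Binary.PropositionalEquality
  using (_≡_; refl; trans; cong; cong₂; sym; module ≡-Reasoning)

2*n≤m+n : ∀ {m n} → n ≤ m → 2 * n ≤ m + n
2*n≤m+n {m} {n} n≤m = begin
  2 * n   ≡⟨ cong (n +_) (+-identityʳ n) ⟩
  n + n   ≤⟨ +-monoˡ-≤ n n≤m ⟩
  m + n   ∎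
  where open ≤-Reasoning

2*m≤m+n : ∀ {m n} → m ≤ n → 2 * m ≤ m + n
2*m≤m+n {m} {n} m≤n = begin
  2 * m   ≡⟨ cong (m +_) (+-identityʳ m) ⟩
  m + m   ≤⟨ +-monoʳ-≤ m m≤n ⟩
  m + n   ∎
  where open ≤-Reasoning

2*-+-mono-≤ : ∀ m s t {n c e} → 2 * m ≤ n → 2 * s ≤ c → 2 * t ≤ e →
              2 * (m + (s + t)) ≤ n + (c + e)
2*-+-mono-≤ m s t {n} {c} {e} 2m≤n 2s≤c 2t≤e = begin
  2 * (m + (s + t))         ≡⟨ *-distribˡ-+ 2 m (s + t) ⟩
  2 * m + 2 * (s + t)       ≡⟨ cong (2 * m +_) (*-distribˡ-+ 2 s t) ⟩
  2 * m + (2 * s + 2 * t)   ≤⟨ +-mono-≤ 2m≤n (+-mono-≤ 2s≤c 2t≤e) ⟩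
  n + (c + e)               ∎
  where open ≤-Reasoning

costAt-suc : ∀ d T → costAt (suc d) T ≡ leaves T + costAt d T
costAt-suc d leaf = refl
costAt-suc d (node l r) =
  trans (cong₂ _+_ (costAt-suc (suc d) l) (costAt-suc (suc d) r))
        (interchange (leaves l) (costAt (suc d) l) (leaves r) (costAt (suc d) r))

cost-node : ∀ l r → cost (node l r) ≡ leaves (node l r) + (cost l + cost r)
cost-node l r = trans (cong₂ _+_ (costAt-suc 0 l) (costAt-suc 0 r))
                      (interchange (leaves l) (cost l) (leaves r) (cost r))

addedDepth : ∀ {T A} → IsAug T A → ℕ
addedDepth aug-leaf = 0
addedDepth (aug-right {r = r} _ p q) = leaves r + (addedDepth p + addedDepth q)
addedDepth (aug-left {l = l} _ p q) = leaves l + (addedDepth p + addedDepth q)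

ucostAt-IsAug : ∀ {T A} d (p : IsAug T A) → ucostAt d A ≡ costAt d T + addedDepth p
ucostAt-IsAug d aug-leaf = sym (+-identityʳ d)
ucostAt-IsAug d (aug-right {l} {r} {l′} {r′} _ p q) = begin
  ucostAt (suc d) l′ + ucostAt (suc (suc d)) r′
    ≡⟨ cong₂ _+_ (ucostAt-IsAug (suc d) p) (ucostAt-IsAug (suc (suc d)) q) ⟩
  (costAt (suc d) l + addedDepth p) + (costAt (suc (suc d)) r + addedDepth q)
    ≡⟨ cong (λ c → (costAt (suc d) l + addedDepth p) + (c + addedDepth q)) (costAt-suc (suc d) r) ⟩
  (costAt (suc d) l + addedDepth p) + ((leaves r + costAt (suc d) r) + addedDepth q)
    ≡⟨ shuffle (costAt (suc d) l) (costAt (suc d) r) (leaves r) (addedDepth p) (addedDepth q) ⟩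
  (costAt (suc d) l + costAt (suc d) r) + (leaves r + (addedDepth p + addedDepth q))
    ∎
  where
  open ≡-Reasoning
  shuffle : ∀ a b m s t → (a + s) + ((m + b) + t) ≡ (a + b) + (m + (s + t))
  shuffle = solve-∀
ucostAt-IsAug d (aug-left {l} {r} {l′} {r′} _ p q) = begin
  ucostAt (suc (suc d)) l′ + ucostAt (suc d) r′
    ≡⟨ cong₂ _+_ (ucostAt-IsAug (suc (suc d)) p) (ucostAt-IsAug (suc d) q) ⟩
  (costAt (suc (suc d)) l + addedDepth p) + (costAt (suc d) r + addedDepth q)
    ≡⟨ cong (λ c → (c + addedDepth p) + (costAt (suc d) r + addedDepth q)) (costAt-suc (suc d) l) ⟩
  ((leaves l + costAt (suc d) l) + addedDepth p) + (costAt (suc d) r + addedDepth q)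
    ≡⟨ shuffle (costAt (suc d) l) (costAt (suc d) r) (leaves l) (addedDepth p) (addedDepth q) ⟩
  (costAt (suc d) l + costAt (suc d) r) + (leaves l + (addedDepth p + addedDepth q))
    ∎
  where
  open ≡-Reasoning
  shuffle : ∀ a b m s t → ((m + a) + s) + (b + t) ≡ (a + b) + (m + (s + t))
  shuffle = solve-∀

2*addedDepth≤cost : ∀ {T A} (p : IsAug T A) → 2 * addedDepth p ≤ cost T
2*addedDepth≤cost aug-leaf = z≤n
2*addedDepth≤cost (aug-right {l} {r} r≤l p q) rewrite cost-node l r =
  2*-+-mono-≤ (leaves r) (addedDepth p) (addedDepth q)
              (2*n≤m+n r≤l) (2*addedDepth≤cost p) (2*addedDepth≤cost q)
2*addedDepth≤cost (aug-left {l} {r} l≤r p q) rewrite cost-node l r =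
  2*-+-mono-≤ (leaves l) (addedDepth p) (addedDepth q)
              (2*m≤m+n l≤r) (2*addedDepth≤cost p) (2*addedDepth≤cost q)

lemma1 : (T : BT) (A : UT) → IsAug T A → 2 * ucost A ≤ 3 * cost T
lemma1 T A p = begin
  2 * ucost A                      ≡⟨ cong (2 *_) (ucostAt-IsAug 0 p) ⟩
  2 * (cost T + addedDepth p)      ≡⟨ *-distribˡ-+ 2 (cost T) (addedDepth p) ⟩
  2 * cost T + 2 * addedDepth p    ≤⟨ +-monoʳ-≤ (2 * cost T) (2*addedDepth≤cost p) ⟩
  2 * cost T + cost T              ≡⟨ +-comm (2 * cost T) (cost T) ⟩
  3 * cost T                       ∎
  where open ≤-Reasoning
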